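{- Let $\sigma\in S_n$ be a word on the alphabet $X=\{x_1<\dots<x_n\}$ and let $T=\varphi(\sigma)$. For each $i=1,\dots,n-1$, let $t_i\in\widehat{X}$ be the third vertex of the unique face of $T$ containing the side $\{x_i,x_{i+1}\}$ of $P$. Then: (1) the letter $x_i$ is to the left of the letter $x_{i+1}$ in $\sigma$ if and only if $t_i<x_i$; (2) if the letters $x_i,x_{i+1},\dots,x_j$ with $j\geq i+2$ appear in this order (from left to right) in $\sigma$, then $t_{j-1}\leq t_{j-2}\leq\dots\leq t_i<x_i$; (3) for every word $w$ of length $n$ on the alphabet $\mathcal{C}$, $\Phi(w)$ is a simple colored triangulation.
   Context: $X=\{x_1<\dots<x_n\}$ is a set of positive integers, $\widehat{X}=X\cup\{0,\infty\}$ with $0<x_1<\dots<x_n<\infty$, and $P$ is a convex $(n+2)$-gon with vertices labelled by $\widehat{X}$ in clockwise increasing order. Permutations $\sigma\in S_n$ are words $x_{i_1}\cdots x_{i_n}$ using each letter of $X$ once. The triangulation $\varphi(\sigma)$ of $P$: for $k=1,\dots,n-1$, with $Y_k=\widehat{X}\setminus\{x_{i_1},\dots,x_{i_{k-1}}\}$, draw the diagonal joining the predecessor and successor of $x_{i_k}$ in $Y_k$; these $n-1$ diagonals form $\varphi(\sigma)$. Each face of a triangulation, with vertices $a<b<c$, is labelled by its middle vertex $b$ (a bijection between faces and $X$). $\mathcal{C}=\{c_1<\dots<c_p\}$ is a totally ordered set of colors. For $\mu=(\mu_1,\dots,\mu_p)\in\mathbb{N}^p$ with $\sum\mu_k=n$,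 $\mathcal{C}_{n,\mu}$ is the set of words of length $n$ on $\mathcal{C}$ with exactly $\mu_k$ occurrences of $c_k$ (evaluation $\mu$). The standardization $\mathrm{std}(w)\in S_n$ replaces the occurrences of $c_1$, read left to right, by $x_1,\dots,x_{\mu_1}$, then those of $c_2$ by $x_{\mu_1+1},\dots,x_{\mu_1+\mu_2}$, and so on. Let $\varepsilon_\mu=(c_1,\dots,c_1,c_2,\dots,c_2,\dots,c_p,\dots,c_p)$ ($\mu_k$ copies of $c_k$). A colored triangulation $T_\varepsilon$, for $T\in\mathcal{T}_n$ and $\varepsilon=(\varepsilon_1,\dots,\varepsilon_n)\in\mathcal{C}^n$, is $T$ with the vertex $x_i$ and the face labelled $x_i$ colored $\varepsilon_i$ (vertices $0,\infty$ are uncolored). It is simple if (a) $\varepsilon_1\leq\dots\leq\varepsilon_n$; (b) no diagonal of $T$ joins two vertices of the same color; (c) whenever $\varepsilon_i=\varepsilon_{i+1}$, the third vertex $t_i$ of the face containing the side $\{x_i,x_{i+1}\}$ satisfies $t_i<x_i$. For $w$ of evaluation $\mu$, $\Phi(w)$ is the colored triangulation $T_{\varepsilon_\mu}$ with $T=\varphi(\mathrm{std}(w))$. -}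

module Defs where

open import Data.Nat using (ℕ; zero; suc; _+_; _∸_; _≤_; _<_; _≡ᵇ_; _<ᵇ_)
open import Data.Bool using (Bool; true; false; if_then_else_; _∨_)
open import Data.List using (List; []; _∷_; _++_; length; map; upTo; filter; concatMap; replicate)
open import Data.List.Membership.Propositional using (_∈_)
open import Data.List.Relation.Unary.Unique.Propositional using (Unique)
open import Data.List.Relation.Binary.Permutation.Propositional using (_↭_)
open import Data.Fin as F using (Fin; toℕ)
open import Data.Vec as V using ()
open import Data.Maybe using (Maybe; just; nothing)
open import Data.Product using (_×_; _,_; ∃; ∃-syntax)
open import Data.Sum using (_⊎_)
open import Relation.Binary.PropositionalEquality using (_≡_; _≢_)
open import Relation.Nullary using (¬_)
open import Function.Bundles using (_⇔_)

-- X = {x_1 < ... < x_n} is identified (order-preservingly)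
-- with {1,...,n}; the vertices of P are 0, 1, ..., n, n+1 where n+1
-- plays the role of ∞.

letters : ℕ → List ℕ
letters n = map suc (upTo n)

IsPerm : ℕ → List ℕ → Set
IsPerm n σ = σ ↭ letters n

LeftOf : List ℕ → ℕ → ℕ → Set
LeftOf σ a b = ∃[ u ] ∃[ v ] ∃[ w ] (σ ≡ u ++ (a ∷ v ++ (b ∷ w)))

mem : ℕ → List ℕ → Bool
mem x []       = false
mem x (y ∷ ys) = (x ≡ᵇ y) ∨ mem x ys

-- predecessor of v in Y = {0..n+1} \ R   (0 is never removed)
predIn : List ℕ → ℕ → ℕ
predIn R zero    = zero
predIn R (suc m) = if mem m R then predIn R m else m

-- successor of v in Y = {0..n+1} \ R  (n+1 is never removed)
succFrom : ℕ → List ℕ → ℕ → ℕ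
succFrom zero     R u = u
succFrom (suc f)  R u = if mem u R then succFrom f R (suc u) else u

succIn : ℕ → List ℕ → ℕ → ℕ
succIn n R v = succFrom (suc (suc n)) R (suc v)

-- diagonals: R = letters already removed, then remaining word.
-- For each letter x_{i_k} except the last one, the diagonal joining its
-- predecessor and successor in Y_k.
diags : ℕ → List ℕ → List ℕ → List (ℕ × ℕ)
diags n R []            = []
diags n R (v ∷ [])      = []
diags n R (v ∷ w ∷ rest) = (predIn R v , succIn n R v) ∷ diags n (v ∷ R) (w ∷ rest)

-- φ(σ), a triangulation given as its list of diagonals (a , b) with a < b
phi : ℕ → List ℕ → List (ℕ × ℕ)
phi n σ = diags n [] σ

Cross : ℕ × ℕ → ℕ × ℕ → Set
Cross (a , b) (c , d) = (a < c × c < b × b < d) ⊎ (c < a × a < d × d < b)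

IsDiagonal : ℕ → ℕ × ℕ → Set
IsDiagonal n (a , b) = suc a < b × b ≤ suc n × ¬ (a ≡ 0 × b ≡ suc n)

IsTriangulation : ℕ → List (ℕ × ℕ) → Set
IsTriangulation n T =
  length T ≡ n ∸ 1 × Unique T × (∀ d → d ∈ T → IsDiagonal n d)
  × (∀ d e → d ∈ T → e ∈ T → ¬ Cross d e)

Edge : ℕ → List (ℕ × ℕ) → ℕ → ℕ → Set
Edge n T a b = (b ≡ suc a) ⊎ (a ≡ 0 × b ≡ suc n) ⊎ ((a , b) ∈ T)

IsFace : ℕ → List (ℕ × ℕ) → ℕ → ℕ → ℕ → Set
IsFace n T a b c =
  a < b × b < c × c ≤ suc n × Edge n T a b × Edge n T b c × Edge n T a c

ThirdVertex : ℕ → List (ℕ × ℕ) → ℕ → ℕ → Set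
ThirdVertex n T i t = IsFace n T t i (suc i) ⊎ IsFace n T i (suc i) t

-- Colors: C = Fin p with its natural order c_1 < ... < c_p.

count : ∀ {p} → Fin p → List (Fin p) → ℕ
count c []      = 0
count c (d ∷ w) = if toℕ d ≡ᵇ toℕ c then suc (count c w) else count c w

countLt : ∀ {p} → Fin p → List (Fin p) → ℕ
countLt c []      = 0
countLt c (d ∷ w) = if toℕ d <ᵇ toℕ c then suc (countLt c w) else countLt c w

-- standardization: the k-th occurrence (from the left) of c gets the value
-- (number of letters of w smaller than c) + k
stdAux : ∀ {p} → List (Fin p) → List (Fin p) → List (Fin p) → List ℕ
stdAux w seen []      = []
stdAux w seen (c ∷ r) = (countLt c w + suc (count c seen)) ∷ stdAux w (c ∷ seen) r

std : ∀ {p} → List (Fin p) → List ℕ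
std w = stdAux w [] w

allFinL : ∀ p → List (Fin p)
allFinL p = V.toList (V.allFin p)

epsMu : ∀ {p} → List (Fin p) → List (Fin p)
epsMu {p} w = concatMap (λ c → replicate (count c w) c) (allFinL p)

nth : ∀ {A : Set} → List A → ℕ → Maybe A
nth []       _       = nothing
nth (x ∷ xs) zero    = just x
nth (x ∷ xs) (suc i) = nth xs i

-- color of vertex v of P (vertex x_i = i has color ε_i; 0 and n+1 uncolored)
colorOf : ∀ {p} → List (Fin p) → ℕ → Maybe (Fin p)
colorOf ε zero    = nothing
colorOf ε (suc i) = nth ε i

Simple : ∀ {p} → ℕ → List (ℕ × ℕ) → List (Fin p) → Set
Simple {p} n T ε =
  IsTriangulation n T × length ε ≡ n
  × (∀ i c d → nth ε i ≡ just c → nth ε (suc i) ≡ just d → c F.≤ d)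
  × (∀ a b c → (a , b) ∈ T → colorOf ε a ≡ just c → colorOf ε b ≢ just c)
  × (∀ i c t → 1 ≤ i → i < n → colorOf ε i ≡ just c → colorOf ε (suc i) ≡ just c
       → ThirdVertex n T i t → t < i)

-- Φ(w) = T_{ε_μ} with T = φ(std w); returned as the pair (T , ε_μ)
PhiT : ∀ {p} → List (Fin p) → List (ℕ × ℕ)
PhiT w = phi (length w) (std w)

{-# OPTIONS --safe #-}
module Submission where

-- Order the vertices by removal time: r y is the position of the letter y in σ, and the
-- never-removed vertices 0 and n+1 come last.  Removing z from the current polygon cuts off
-- the ear (a, z, b) spanned by its two current neighbours; this triangle is the face of φ(σ)
-- labelled z, and the pairs a < b occurring as its sides are exactly those such that every
-- vertex strictly between a and b is removed before both of them.  Two such pairs cannot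
-- cross, which makes φ(σ) a triangulation whose edges are precisely these pairs.  The face on
-- the side {i, i+1} is the ear of whichever of i, i+1 is removed first, so its third vertex
-- lies below i exactly when i precedes i+1 in σ; along an increasing run, a larger third
-- vertex at the next side would give two crossing edges.  For colored words, std w lists
-- equally colored letters in increasing order and ε_μ is weakly increasing, so a diagonal
-- with equally colored ends would be an ear whose apex, of the same color, is removed before
-- the smaller end.

open import Defs
open import Algebra.Properties.CommutativeSemigroup using (x∙yz≈y∙xz)
open import Data.Bool using (Bool; true; false; if_then_else_; _∨_)
open import Data.Empty using (⊥)
open import Data.Fin as F using (Fin; toℕ)
open import Data.Fin.Properties using (toℕ-injective)
open import Data.List
  using (List; []; _∷_; _++_; [_]; length; filter; map; upTo; reverse; _ʳ++_; replicate; concatMap; tabulate)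
open import Data.List.Properties
  using (length-++; length-replicate; length-map; length-upTo; filter-notAll; ∷-injective; ∷-injectiveʳ; ++-assoc)
open import Data.List.Membership.Propositional using (_∈_; _∉_)
open import Data.List.Membership.Propositional.Properties
  using (∈-filter⁺; ∈-∃++; ∈-++⁺ˡ; ∈-++⁺ʳ; ∈-++⁻; ∈-map⁺; ∈-map⁻; ∈-upTo⁺; ∈-upTo⁻; ∈-allFin)
open import Data.List.Relation.Binary.Permutation.Propositional using (↭-sym; ↭⇒↭ₛ)
open import Data.List.Relation.Binary.Permutation.Propositional.Properties using (∈-resp-↭; ↭-length)
import Data.List.Relation.Binary.Permutation.Setoid.Properties as Permutationₛ
open import Data.List.Relation.Binary.Subset.Propositional using (_⊆_)
open import Data.List.Relation.Unary.All as All using (All; []; _∷_)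
open import Data.List.Relation.Unary.All.Properties using (All¬⇒¬Any)
open import Data.List.Relation.Unary.AllPairs as AllPairs using (AllPairs; []; _∷_)
import Data.List.Relation.Unary.AllPairs.Properties as AllPairsₚ
open import Data.List.Relation.Unary.Any as Any using (here; there)
open import Data.List.Relation.Unary.Any.Properties using (reverse⁺; reverse⁻)
open import Data.List.Relation.Unary.Unique.Propositional using (Unique)
import Data.List.Relation.Unary.Unique.Propositional.Properties as Unique
open import Data.Maybe using (just)
open import Data.Maybe.Properties using (just-injective)
open import Data.Nat using (ℕ; zero; suc; _+_; _∸_; _≤_; _<_; z≤n; s≤s; _≡ᵇ_; _<ᵇ_)
open import Data.Nat.Properties
open import Data.List.Membership.DecPropositional _≟_ using (_∈?_)
open import Data.Product using (_×_; _,_; ∃-syntax; proj₁; proj₂)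
open import Data.Sum using (_⊎_; inj₁; inj₂)
import Data.Vec as V
open import Function using (_∘_; id)
open import Function.Bundles using (_⇔_; mk⇔; Equivalence)
import Function.Properties.Equivalence as ⇔
open import Relation.Binary.Definitions using (tri<; tri≈; tri>)
open import Relation.Binary.PropositionalEquality hiding ([_])
open import Relation.Nullary using (¬_; does; yes; no; ¬?; contradiction)
open import Relation.Nullary.Decidable using (_×-dec_; dec-true; dec-false)

private variable
  a b i k m t t′ x y z : ℕ
  R u v xs ys : List ℕ

mem≡does : ∀ y R → mem y R ≡ does (y ∈? R)
mem≡does y []      = refl
mem≡does y (x ∷ R) = cong ((y ≡ᵇ x) ∨_) (mem≡does y R)

∈⇒mem≡true : y ∈ R → mem y R ≡ true
∈⇒mem≡true {y} {R} y∈R = trans (mem≡does y R) (dec-true (y ∈? R) y∈R)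

∉⇒mem≡false : y ∉ R → mem y R ≡ false
∉⇒mem≡false {y} {R} y∉R = trans (mem≡does y R) (dec-false (y ∈? R) y∉R)

-- With R the letters removed so far, a and b are consecutive vertices of the current polygon.
Neighbours : List ℕ → ℕ → ℕ → Set
Neighbours R a b = a < b × a ∉ R × b ∉ R × (∀ y → a < y → y < b → y ∈ R)

predIn-spec : 0 ∉ R → ∀ m → predIn R (suc m) ≤ m × predIn R (suc m) ∉ R
               × (∀ y → predIn R (suc m) < y → y ≤ m → y ∈ R)
predIn-spec {R} 0∉R m with m ∈? R
predIn-spec {R} 0∉R m       | no m∉R rewrite ∉⇒mem≡false m∉R =
  ≤-refl , m∉R , λ y m<y y≤m → contradiction y≤m (<⇒≱ m<y)
predIn-spec {R} 0∉R zero    | yes 0∈R = contradiction 0∈R 0∉R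
predIn-spec {R} 0∉R (suc m) | yes m+1∈R rewrite ∈⇒mem≡true m+1∈R
  with p≤m , p∉R , between ← predIn-spec 0∉R m =
  m≤n⇒m≤1+n p≤m , p∉R , between′
  where
  between′ : ∀ y → predIn R (suc m) < y → y ≤ suc m → y ∈ R
  between′ y p<y y≤m+1 with m≤n⇒m<n∨m≡n y≤m+1
  ... | inj₁ y<m+1 = between y p<y (≤-pred y<m+1)
  ... | inj₂ refl  = m+1∈R

predIn-neighbours : 0 ∉ R → x ∉ R → 0 < x → Neighbours R (predIn R x) x
predIn-neighbours {x = suc m} 0∉R x∉R _ =
  let p≤m , p∉R , between = predIn-spec 0∉R m
  in s≤s p≤m , p∉R , x∉R , λ y p<y y<x → between y p<y (≤-pred y<x)

succFrom-spec : ∀ f {R u c} → u ≤ c → c < u + f → c ∉ R →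
                 u ≤ succFrom f R u × succFrom f R u ∉ R
                 × (∀ y → u ≤ y → y < succFrom f R u → y ∈ R)
succFrom-spec zero    {u = u} u≤c c<u+0 _ =
  contradiction (subst (_ <_) (+-identityʳ u) c<u+0) (≤⇒≯ u≤c)
succFrom-spec (suc f) {R} {u} {c} u≤c c<u+f c∉R with u ∈? R
... | no u∉R rewrite ∉⇒mem≡false u∉R =
  ≤-refl , u∉R , λ y u≤y y<u → contradiction u≤y (<⇒≱ y<u)
... | yes u∈R rewrite ∈⇒mem≡true u∈R
  with u<s , s∉R , between ←
         succFrom-spec f (≤∧≢⇒< u≤c λ { refl → c∉R u∈R }) (subst (c <_) (+-suc u f) c<u+f) c∉R =
  <⇒≤ u<s , s∉R , between′
  where
  between′ : ∀ y → u ≤ y → y < succFrom f R (suc u) → y ∈ R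
  between′ y u≤y y<s with m≤n⇒m<n∨m≡n u≤y
  ... | inj₁ u<y  = between y u<y y<s
  ... | inj₂ refl = u∈R

succIn-neighbours : ∀ n → suc n ∉ R → x ∉ R → x ≤ n → Neighbours R x (succIn n R x)
succIn-neighbours {x = x} n n+1∉R x∉R x≤n =
  let x<s , s∉R , between =
        succFrom-spec (suc (suc n)) (s≤s x≤n) (m≤n+m (suc (suc n)) (suc x)) n+1∉R
  in x<s , x∉R , s∉R , between

neighbours-uniqueˡ : Neighbours R a x → Neighbours R b x → a ≡ b
neighbours-uniqueˡ {a = a} {b = b} (a<x , a∉R , _ , betweenᵃ) (b<x , b∉R , _ , betweenᵇ)
  with <-cmp a b
... | tri< a<b _ _ = contradiction (betweenᵃ _ a<b b<x) b∉R
... | tri≈ _ a≡b _ = a≡b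
... | tri> _ _ b<a = contradiction (betweenᵇ _ b<a a<x) a∉R

neighbours-uniqueʳ : Neighbours R x a → Neighbours R x b → a ≡ b
neighbours-uniqueʳ {a = a} {b = b} (x<a , _ , a∉R , betweenᵃ) (x<b , _ , b∉R , betweenᵇ)
  with <-cmp a b
... | tri< a<b _ _ = contradiction (betweenᵇ _ x<a a<b) a∉R
... | tri≈ _ a≡b _ = a≡b
... | tri> _ _ b<a = contradiction (betweenᵃ _ x<b b<a) b∉R

split-compare : ∀ {A : Set} (u u′ : List A) {x x′ : A} {v v′} → u ++ x ∷ v ≡ u′ ++ x′ ∷ v′ →
  (u ≡ u′ × x ≡ x′) ⊎ (∃[ m ] u ≡ u′ ++ x′ ∷ m) ⊎ (∃[ m ] u′ ≡ u ++ x ∷ m)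
split-compare []      []        refl = inj₁ (refl , refl)
split-compare []      (x′ ∷ u′) refl = inj₂ (inj₂ (u′ , refl))
split-compare (x ∷ u) []        refl = inj₂ (inj₁ (u , refl))
split-compare (x ∷ u) (x′ ∷ u′) eq with refl , eq′ ← ∷-injective eq with split-compare u u′ eq′
... | inj₁ (refl , x≡x′)      = inj₁ (refl , x≡x′)
... | inj₂ (inj₁ (m , refl)) = inj₂ (inj₁ (m , refl))
... | inj₂ (inj₂ (m , refl)) = inj₂ (inj₂ (m , refl))

rank : List ℕ → ℕ → ℕ
rank []       y = 0
rank (x ∷ xs) y with y ≟ x
... | yes _ = 0
... | no _  = suc (rank xs y)

rank-head : ∀ x xs → rank (x ∷ xs) x ≡ 0
rank-head x xs with x ≟ x
... | yes _  = refl
... | no x≢x = contradiction refl x≢x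

rank-∈ : y ∈ xs → rank xs y < length xs
rank-∈ {y} {x ∷ xs} y∈ with y ≟ x | y∈
... | yes _   | _          = s≤s z≤n
... | no y≢x  | here y≡x   = contradiction y≡x y≢x
... | no _    | there y∈xs = s≤s (rank-∈ y∈xs)

rank-∉ : y ∉ xs → rank xs y ≡ length xs
rank-∉ {y} {[]}     _   = refl
rank-∉ {y} {x ∷ xs} y∉ with y ≟ x
... | yes y≡x = contradiction (here y≡x) y∉
... | no _    = cong suc (rank-∉ (y∉ ∘ there))

rank-++-∈ : y ∈ u → rank (u ++ v) y < length u
rank-++-∈ {y} {x ∷ u} y∈ with y ≟ x | y∈
... | yes _   | _         = s≤s z≤n
... | no y≢x  | here y≡x  = contradiction y≡x y≢x
... | no _    | there y∈u = s≤s (rank-++-∈ y∈u)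

rank-++-∉ : y ∉ u → rank (u ++ v) y ≡ length u + rank v y
rank-++-∉ {y} {[]}    _   = refl
rank-++-∉ {y} {x ∷ u} y∉ with y ≟ x
... | yes y≡x = contradiction (here y≡x) y∉
... | no _    = cong suc (rank-++-∉ (y∉ ∘ there))

rank-injective : y ∈ xs → rank xs x ≡ rank xs y → x ≡ y
rank-injective {y} {w ∷ xs} {x} y∈ eq with x ≟ w | y ≟ w | y∈
... | yes refl | yes refl | _          = refl
... | no _     | no y≢w   | here y≡w   = contradiction y≡w y≢w
... | no _     | no _     | there y∈xs = rank-injective y∈xs (suc-injective eq)

unique⇒∉prefix : Unique (u ++ z ∷ v) → z ∉ u
unique⇒∉prefix {x ∷ u} (x≢ ∷ _)   (here refl) = All¬⇒¬Any x≢ (∈-++⁺ʳ u (here refl))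
unique⇒∉prefix {x ∷ u} (_ ∷ uniq) (there z∈u) = unique⇒∉prefix uniq z∈u

rank-split : Unique (u ++ z ∷ v) → rank (u ++ z ∷ v) z ≡ length u
rank-split {u} {z} {v} uniq = begin
  rank (u ++ z ∷ v) z       ≡⟨ rank-++-∉ (unique⇒∉prefix uniq) ⟩
  length u + rank (z ∷ v) z ≡⟨ cong (length u +_) (rank-head z v) ⟩
  length u + 0              ≡⟨ +-identityʳ (length u) ⟩
  length u                  ∎
  where open ≡-Reasoning

∈-remove : y ∈ u ++ x ∷ v → y ≢ x → y ∈ u ++ v
∈-remove {u = u} y∈ y≢x with ∈-++⁻ u y∈
... | inj₁ y∈u         = ∈-++⁺ˡ y∈u
... | inj₂ (here y≡x)  = contradiction y≡x y≢x
... | inj₂ (there y∈v) = ∈-++⁺ʳ u y∈v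

unique-⊆⇒length≤ : Unique xs → xs ⊆ ys → length xs ≤ length ys
unique-⊆⇒length≤ [] _ = z≤n
unique-⊆⇒length≤ {x ∷ xs} (x≢ ∷ uniq) xs⊆ys with u , v , refl ← ∈-∃++ (xs⊆ys (here refl)) =
  begin
    suc (length xs)      ≤⟨ s≤s (unique-⊆⇒length≤ uniq xs⊆u++v) ⟩
    suc (length (u ++ v)) ≡⟨ cong suc (length-++ u) ⟩
    suc (length u + length v) ≡⟨ +-suc (length u) (length v) ⟨
    length u + length (x ∷ v) ≡⟨ length-++ u ⟨
    length (u ++ x ∷ v) ∎
  where
  open ≤-Reasoning
  xs⊆u++v : xs ⊆ u ++ v
  xs⊆u++v y∈xs = ∈-remove (xs⊆ys (there y∈xs)) λ { refl → All¬⇒¬Any x≢ y∈xs }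

unique-⊆∧length≥⇒⊇ : Unique xs → xs ⊆ ys → length ys ≤ length xs → ys ⊆ xs
unique-⊆∧length≥⇒⊇ {xs} {ys} uniq xs⊆ys ys≤xs {y} y∈ys with y ∈? xs
... | yes y∈xs = y∈xs
... | no  y∉xs = contradiction ys≤xs (<⇒≱ (begin-strict
      length xs              ≤⟨ unique-⊆⇒length≤ uniq xs⊆others ⟩
      length (filter P? ys)  <⟨ filter-notAll P? ys (Any.map (λ { refl y≢y → y≢y refl }) y∈ys) ⟩
      length ys              ∎))
  where
  open ≤-Reasoning
  P? = λ x → ¬? (x ≟ y)
  xs⊆others : xs ⊆ filter P? ys
  xs⊆others x∈xs = ∈-filter⁺ P? (xs⊆ys x∈xs) λ { refl → y∉xs x∈xs }

≤suc-elim : ∀ {P : ℕ → Set} {hi} → (∀ y → y ≤ hi → P y) → P (suc hi) → ∀ y → y ≤ suc hi → P y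
≤suc-elim below top y y≤hi+1 with m≤n⇒m<n∨m≡n y≤hi+1
... | inj₁ y<hi+1 = below y (≤-pred y<hi+1)
... | inj₂ refl   = top

argmax-interval : (f : ℕ → ℕ) {lo hi : ℕ} → lo ≤ hi →
  ∃[ z ] lo ≤ z × z ≤ hi × (∀ y → y ≤ hi → lo ≤ y → f y ≤ f z)
argmax-interval f {hi = zero} lo≤0 = 0 , lo≤0 , z≤n , λ { _ z≤n _ → ≤-refl }
argmax-interval f {lo} {suc hi} lo≤hi+1 with lo ≤? hi
... | no lo≰hi = suc hi , lo≤hi+1 , ≤-refl ,
      ≤suc-elim (λ y y≤hi lo≤y → contradiction (≤-trans lo≤y y≤hi) lo≰hi) (λ _ → ≤-refl)
... | yes lo≤hi with z , lo≤z , z≤hi , max ← argmax-interval f lo≤hi with f z ≤? f (suc hi)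
...   | yes fz≤ = suc hi , lo≤hi+1 , ≤-refl ,
        ≤suc-elim (λ y y≤hi lo≤y → ≤-trans (max y y≤hi lo≤y) fz≤) (λ _ → ≤-refl)
...   | no fz≰  = z , lo≤z , m≤n⇒m≤1+n z≤hi ,
        ≤suc-elim max (λ _ → <⇒≤ (≰⇒> fz≰))

-- The entry of diags n R contributed by the letter z when it follows the letters u.
diagonal : ℕ → List ℕ → List ℕ → ℕ → ℕ × ℕ
diagonal n R u z = predIn (u ʳ++ R) z , succIn n (u ʳ++ R) z

∈-diags⁻ : ∀ {n} R σ {d} → d ∈ diags n R σ →
  ∃[ u ] ∃[ z ] ∃[ w ] ∃[ rest ] σ ≡ u ++ z ∷ w ∷ rest × d ≡ diagonal n R u z
∈-diags⁻ R (v ∷ w ∷ rest) (here refl) = [] , v , w , rest , refl , refl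
∈-diags⁻ R (v ∷ w ∷ rest) (there d∈)
  with u , z , w′ , rest′ , eq , d≡ ← ∈-diags⁻ (v ∷ R) (w ∷ rest) d∈ =
  v ∷ u , z , w′ , rest′ , cong (v ∷_) eq , d≡

∈-diags⁺ : ∀ {n} R u z w rest → diagonal n R u z ∈ diags n R (u ++ z ∷ w ∷ rest)
∈-diags⁺ R []          z w rest = here refl
∈-diags⁺ R (x ∷ [])    z w rest = there (∈-diags⁺ (x ∷ R) [] z w rest)
∈-diags⁺ R (x ∷ y ∷ u) z w rest = there (∈-diags⁺ (x ∷ R) (y ∷ u) z w rest)

length-diags : ∀ n R σ → length (diags n R σ) ≡ length σ ∸ 1
length-diags n R []             = refl
length-diags n R (v ∷ [])       = refl
length-diags n R (v ∷ w ∷ rest) = cong suc (length-diags n (v ∷ R) (w ∷ rest))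

diags-unique : ∀ {n} R σ → Unique σ →
  (∀ {u z v u′ z′ v′} → σ ≡ u ++ z ∷ v → σ ≡ u′ ++ z′ ∷ v′ →
     diagonal n R u z ≡ diagonal n R u′ z′ → z ≡ z′) →
  Unique (diags n R σ)
diags-unique R []             _          _   = []
diags-unique R (v ∷ [])       _          _   = []
diags-unique {n} R (v ∷ w ∷ rest) (v≢ ∷ uniq) inj =
  All.tabulate head-fresh ∷ diags-unique (v ∷ R) (w ∷ rest) uniq
    λ {u} {_} {_} {u′} eq eq′ → inj {u = v ∷ u} {u′ = v ∷ u′} (cong (v ∷_) eq) (cong (v ∷_) eq′)
  where
  head-fresh : ∀ {d} → d ∈ diags n (v ∷ R) (w ∷ rest) → diagonal n R [] v ≢ d
  head-fresh d∈ refl with u , z , _ , _ , eq , d≡ ← ∈-diags⁻ (v ∷ R) (w ∷ rest) d∈ =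
    All¬⇒¬Any v≢ (subst (_∈ w ∷ rest) z≡v (subst (z ∈_) (sym eq) (∈-++⁺ʳ u (here refl))))
    where z≡v = sym (inj {u = []} {u′ = v ∷ u} refl (cong (v ∷_) eq) d≡)

-- The triangulation φ(σ) of a permutation σ

record PermutationOf (n : ℕ) (σ : List ℕ) : Set where
  field
    unique  : Unique σ
    bounded : ∀ {y} → y ∈ σ → 1 ≤ y × y ≤ n
    length≡ : length σ ≡ n

∈-letters⁺ : ∀ {n y} → 1 ≤ y → y ≤ n → y ∈ letters n
∈-letters⁺ {y = suc y} _ y<n = ∈-map⁺ suc (∈-upTo⁺ y<n)

∈-letters⁻ : ∀ {n y} → y ∈ letters n → 1 ≤ y × y ≤ n
∈-letters⁻ y∈ with x , x∈ , refl ← ∈-map⁻ suc y∈ = s≤s z≤n , ∈-upTo⁻ x∈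

length-letters : ∀ n → length (letters n) ≡ n
length-letters n = trans (length-map suc (upTo n)) (length-upTo n)

isPerm⇒permutationOf : ∀ {n σ} → IsPerm n σ → PermutationOf n σ
isPerm⇒permutationOf {n} σ↭ = record
  { unique  = Permutationₛ.Unique-resp-↭ (setoid ℕ) (↭⇒↭ₛ (↭-sym σ↭))
                (Unique.map⁺ suc-injective (Unique.upTo⁺ n))
  ; bounded = ∈-letters⁻ ∘ ∈-resp-↭ σ↭
  ; length≡ = trans (↭-length σ↭) (length-letters n)
  }

module Triangulation {n σ} (perm : PermutationOf n σ) where

  open PermutationOf perm

  T : List (ℕ × ℕ)
  T = phi n σ

  complete : 1 ≤ y → y ≤ n → y ∈ σ
  complete 1≤y y≤n = unique-⊆∧length≥⇒⊇ unique
    (λ y∈σ → let 1≤ , ≤n = bounded y∈σ in ∈-letters⁺ 1≤ ≤n)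
    (≤-reflexive (trans (length-letters n) (sym length≡)))
    (∈-letters⁺ 1≤y y≤n)

  0∉σ : 0 ∉ σ
  0∉σ 0∈σ with () ← proj₁ (bounded 0∈σ)

  n+1∉σ : suc n ∉ σ
  n+1∉σ n+1∈σ = 1+n≰n (proj₂ (bounded n+1∈σ))

  -- The removal time of a vertex; 0 and n+1 are never removed and come last.
  r : ℕ → ℕ
  r = rank σ

  rank-inside : y ∈ σ → r y < n
  rank-inside y∈σ = subst (_ <_) length≡ (rank-∈ y∈σ)

  rank-outside : y ∉ σ → r y ≡ n
  rank-outside y∉σ = trans (rank-∉ y∉σ) length≡

  rank≤n : ∀ y → r y ≤ n
  rank≤n y with y ∈? σ
  ... | yes y∈σ = <⇒≤ (rank-inside y∈σ)
  ... | no  y∉σ = ≤-reflexive (rank-outside y∉σ)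

  rank-≢ : z ∈ σ → y ≢ z → r y ≢ r z
  rank-≢ z∈σ y≢z = y≢z ∘ rank-injective z∈σ

  prefix⇔rank< : σ ≡ u ++ z ∷ v → (y ∈ u ⇔ r y < r z)
  prefix⇔rank< {u} {z} {v} {y} refl = mk⇔
    (λ y∈u → subst (r y <_) (sym (rank-split unique)) (rank-++-∈ y∈u))
    from
    where
    from : r y < r z → y ∈ u
    from ry<rz with y ∈? u
    ... | yes y∈u = y∈u
    ... | no  y∉u = contradiction ry<rz (≤⇒≯ (begin
          r z                        ≡⟨ rank-split unique ⟩
          length u                   ≤⟨ m≤m+n (length u) _ ⟩
          length u + rank (z ∷ v) y  ≡⟨ rank-++-∉ y∉u ⟨
          r y                        ∎))
      where open ≤-Reasoning

  rank>⇒∈suffix : σ ≡ u ++ z ∷ v → y ∈ σ → r z < r y → y ∈ v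
  rank>⇒∈suffix {u} eq y∈σ rz<ry with ∈-++⁻ u (subst (_ ∈_) eq y∈σ)
  ... | inj₁ y∈u         = contradiction (Equivalence.to (prefix⇔rank< eq) y∈u) (<-asym rz<ry)
  ... | inj₂ (here refl) = contradiction rz<ry (<-irrefl refl)
  ... | inj₂ (there y∈v) = y∈v

  leftOf⇒rank< : LeftOf σ a b → r a < r b
  leftOf⇒rank< {a} {b} (u , v , w , eq) =
    Equivalence.to (prefix⇔rank< (trans eq (sym (++-assoc u (a ∷ v) (b ∷ w))))) (∈-++⁺ʳ u (here refl))

  rank<⇒leftOf : b ∈ σ → r a < r b → LeftOf σ a b
  rank<⇒leftOf {b} {a} b∈σ ra<rb with u , w , eq ← ∈-∃++ b∈σ
    with u₁ , v , refl ← ∈-∃++ (Equivalence.from (prefix⇔rank< eq) ra<rb) =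
    u₁ , v , w , trans eq (++-assoc u₁ (a ∷ v) (b ∷ w))

  -- a and b become neighbours in some intermediate polygon Y_k.
  Adjacent : ℕ → ℕ → Set
  Adjacent a b = ∀ y → a < y → y < b → r y < r a × r y < r b

  adjacent-noncrossing : a < x → x < b → b < y → Adjacent a b → Adjacent x y → ⊥
  adjacent-noncrossing a<x x<b b<y adjᵃᵇ adjˣʸ =
    <-asym (proj₂ (adjᵃᵇ _ a<x x<b)) (proj₁ (adjˣʸ _ x<b b<y))

  -- Removing z cuts off the triangle a z b, the face of φ(σ) labelled z.
  Ear : ℕ → ℕ → ℕ → Set
  Ear a z b = a < z × z < b × r z < r a × r z < r b × (∀ y → a < y → y < b → y ≢ z → r y < r z)

  ear-sides-adjacent : Ear a z b → Adjacent a z × Adjacent z b × Adjacent a b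
  ear-sides-adjacent {a} {z} {b} (a<z , z<b , rz<ra , rz<rb , below) = left , right , outer
    where
    left : Adjacent a z
    left y a<y y<z = let ry<rz = below y a<y (<-trans y<z z<b) (<⇒≢ y<z) in <-trans ry<rz rz<ra , ry<rz
    right : Adjacent z b
    right y z<y y<b = let ry<rz = below y (<-trans a<z z<y) y<b (<⇒≢ z<y ∘ sym) in ry<rz , <-trans ry<rz rz<rb
    outer : Adjacent a b
    outer y a<y y<b with y ≟ z
    ... | yes refl = rz<ra , rz<rb
    ... | no y≢z   = let ry<rz = below y a<y y<b y≢z in <-trans ry<rz rz<ra , <-trans ry<rz rz<rb

  ear-apex-unique : Ear a z b → Ear a x b → z ≡ x
  ear-apex-unique {z = z} {x = x} (a<z , z<b , _ , _ , below) (a<x , x<b , _ , _ , belowˣ) with z ≟ x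
  ... | yes z≡x = z≡x
  ... | no  z≢x = contradiction (below x a<x x<b (z≢x ∘ sym)) (<-asym (belowˣ z a<z z<b z≢x))

  ear-apex∈σ : Ear a z b → z ∈ σ
  ear-apex∈σ {a} {z} (_ , _ , rz<ra , _) with z ∈? σ
  ... | yes z∈σ = z∈σ
  ... | no  z∉σ = contradiction (subst (_< r a) (rank-outside z∉σ) rz<ra) (≤⇒≯ (rank≤n a))

  ear-bounded : Ear a z b → b ≤ suc n
  ear-bounded {z = z} ear@(a<z , z<b , _ , _ , below) = ≮⇒≥ λ n+1<b →
    let z<n+1 = s≤s (proj₂ (bounded (ear-apex∈σ ear)))
        rn+1<rz = below (suc n) (<-trans a<z z<n+1) n+1<b (<⇒≢ z<n+1 ∘ sym)
    in contradiction (subst (_< r z) (rank-outside n+1∉σ) rn+1<rz) (<-asym (rank-inside (ear-apex∈σ ear)))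

  ¬outer⇔later-letter : Ear a z b → ((¬ (a ≡ 0 × b ≡ suc n)) ⇔ (∃[ y ] y ∈ σ × r z < r y))
  ¬outer⇔later-letter {a} {z} {b} ear@(a<z , z<b , rz<ra , rz<rb , below) = mk⇔ to from
    where
    apex≤n = proj₂ (bounded (ear-apex∈σ ear))
    to : ¬ (a ≡ 0 × b ≡ suc n) → ∃[ y ] y ∈ σ × r z < r y
    to inner with a ≟ 0
    ... | no a≢0 = a , complete (n≢0⇒n>0 a≢0) (≤-trans (<⇒≤ a<z) apex≤n) , rz<ra
    ... | yes a≡0 =
      let b≤n = ≤-pred (≤∧≢⇒< (ear-bounded ear) (λ b≡n+1 → inner (a≡0 , b≡n+1)))
      in b , complete (≤-trans (s≤s z≤n) z<b) b≤n , rz<rb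
    from : ∃[ y ] y ∈ σ × r z < r y → ¬ (a ≡ 0 × b ≡ suc n)
    from (y , y∈σ , rz<ry) (refl , refl) =
      let 1≤y , y≤n = bounded y∈σ
      in <-asym rz<ry (below y 1≤y (s≤s y≤n) (<⇒≢ rz<ry ∘ sym ∘ cong r))

  removed⇔ : σ ≡ u ++ z ∷ v → (y ∈ reverse u ⇔ r y < r z)
  removed⇔ eq = ⇔.trans (mk⇔ reverse⁻ reverse⁺) (prefix⇔rank< eq)

  ear⇔neighbours : σ ≡ u ++ z ∷ v → (Ear a z b ⇔ (Neighbours (reverse u) a z × Neighbours (reverse u) z b))
  ear⇔neighbours {u} {z} {v} {a} {b} eq = mk⇔ to from
    where
    removed : ∀ {y} → y ∈ reverse u ⇔ r y < r z
    removed = removed⇔ eq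
    z∈σ = subst (z ∈_) (sym eq) (∈-++⁺ʳ u (here refl))
    z∉R : z ∉ reverse u
    z∉R z∈R = <-irrefl refl (Equivalence.to removed z∈R)
    kept : ∀ {y} → r z < r y → y ∉ reverse u
    kept rz<ry y∈R = <-asym rz<ry (Equivalence.to removed y∈R)
    survivor : ∀ {y} → y ∉ reverse u → y ≢ z → r z < r y
    survivor y∉R y≢z = ≤∧≢⇒< (≮⇒≥ (y∉R ∘ Equivalence.from removed)) (rank-≢ z∈σ y≢z ∘ sym)
    to : Ear a z b → Neighbours (reverse u) a z × Neighbours (reverse u) z b
    to (a<z , z<b , rz<ra , rz<rb , below) =
        (a<z , kept rz<ra , z∉R , λ y a<y y<z →
          Equivalence.from removed (below y a<y (<-trans y<z z<b) (<⇒≢ y<z)))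
      , (z<b , z∉R , kept rz<rb , λ y z<y y<b →
          Equivalence.from removed (below y (<-trans a<z z<y) y<b (<⇒≢ z<y ∘ sym)))
    from : Neighbours (reverse u) a z × Neighbours (reverse u) z b → Ear a z b
    from ((a<z , a∉R , _ , removedˡ) , (z<b , _ , b∉R , removedʳ)) =
      a<z , z<b , survivor a∉R (<⇒≢ a<z) , survivor b∉R (<⇒≢ z<b ∘ sym) , below
      where
      below : ∀ y → a < y → y < b → y ≢ z → r y < r z
      below y a<y y<b y≢z with <-cmp y z
      ... | tri< y<z _ _ = Equivalence.to removed (removedˡ y a<y y<z)
      ... | tri≈ _ y≡z _ = contradiction y≡z y≢z
      ... | tri> _ _ z<y = Equivalence.to removed (removedʳ y z<y y<b)

  ear-of-split : σ ≡ u ++ z ∷ v → Ear (predIn (reverse u) z) z (succIn n (reverse u) z)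
  ear-of-split {u} {z} eq = Equivalence.from (ear⇔neighbours eq)
    ( predIn-neighbours (0∉σ ∘ removed⊆σ) z∉R (proj₁ z-bounds)
    , succIn-neighbours n (n+1∉σ ∘ removed⊆σ) z∉R (proj₂ z-bounds))
    where
    removed⊆σ : ∀ {y} → y ∈ reverse u → y ∈ σ
    removed⊆σ y∈R = subst (_ ∈_) (sym eq) (∈-++⁺ˡ (reverse⁻ {xs = u} y∈R))
    z∉R : z ∉ reverse u
    z∉R z∈R = <-irrefl refl (Equivalence.to (removed⇔ eq) z∈R)
    z-bounds = bounded (subst (z ∈_) (sym eq) (∈-++⁺ʳ u (here refl)))

  diagonal-of-ear : σ ≡ u ++ z ∷ v → Ear a z b → diagonal n [] u z ≡ (a , b)
  diagonal-of-ear eq ear =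
    let pred-nb , succ-nb = Equivalence.to (ear⇔neighbours eq) (ear-of-split eq)
        left-nb , right-nb = Equivalence.to (ear⇔neighbours eq) ear
    in cong₂ _,_ (neighbours-uniqueˡ pred-nb left-nb) (neighbours-uniqueʳ succ-nb right-nb)

  ∈T⇒ear : (a , b) ∈ T → ∃[ z ] Ear a z b × ¬ (a ≡ 0 × b ≡ suc n)
  ∈T⇒ear {a} {b} ab∈T with u , z , w , rest , eq , ab≡ ← ∈-diags⁻ [] σ ab∈T =
    z , ear , Equivalence.from (¬outer⇔later-letter ear) (w , w∈σ , rz<rw)
    where
    ear : Ear a z b
    ear = subst (λ (a , b) → Ear a z b) (sym ab≡) (ear-of-split eq)
    eq′ : σ ≡ (u ++ [ z ]) ++ w ∷ rest
    eq′ = trans eq (sym (++-assoc u [ z ] (w ∷ rest)))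
    w∈σ = subst (w ∈_) (sym eq′) (∈-++⁺ʳ (u ++ [ z ]) (here refl))
    rz<rw = Equivalence.to (prefix⇔rank< eq′) (∈-++⁺ʳ u (here refl))

  ear⇒∈T : Ear a z b → ¬ (a ≡ 0 × b ≡ suc n) → (a , b) ∈ T
  ear⇒∈T {a} {z} {b} ear inner
    with u , v , eq ← ∈-∃++ (ear-apex∈σ ear)
    with y , y∈σ , rz<ry ← Equivalence.to (¬outer⇔later-letter ear) inner =
    diagonal∈T eq (rank>⇒∈suffix eq y∈σ rz<ry)
    where
    diagonal∈T : ∀ {v} → σ ≡ u ++ z ∷ v → y ∈ v → (a , b) ∈ T
    diagonal∈T {w ∷ rest} eq _ =
      subst₂ _∈_ (diagonal-of-ear eq ear) (cong (diags n []) (sym eq)) (∈-diags⁺ [] u z w rest)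

  adjacent⇒ear : suc a < b → b ≤ suc n → Adjacent a b → ∃[ z ] Ear a z b
  adjacent⇒ear {a} {suc hi} (s≤s a<hi) b≤n+1 adj with z , a<z , z≤hi , max ← argmax-interval r a<hi =
    z , a<z , s≤s z≤hi , rz<ra , rz<rb ,
    λ y a<y y<b y≢z → ≤∧≢⇒< (max y (≤-pred y<b) a<y) (rank-≢ z∈σ y≢z)
    where
    z∈σ = complete (≤-trans (s≤s z≤n) a<z) (≤-trans z≤hi (≤-pred b≤n+1))
    rz<ra = proj₁ (adj z a<z (s≤s z≤hi))
    rz<rb = proj₂ (adj z a<z (s≤s z≤hi))

  edge⇒adjacent : Edge n T a b → Adjacent a b
  edge⇒adjacent (inj₁ refl) y a<y y<a+1 = contradiction (≤-pred y<a+1) (<⇒≱ a<y)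
  edge⇒adjacent (inj₂ (inj₁ (refl , refl))) y 0<y y<n+1 =
    let ry<n = rank-inside (complete 0<y (≤-pred y<n+1))
    in subst (r y <_) (sym (rank-outside 0∉σ)) ry<n , subst (r y <_) (sym (rank-outside n+1∉σ)) ry<n
  edge⇒adjacent (inj₂ (inj₂ ab∈T)) with _ , ear , _ ← ∈T⇒ear ab∈T = proj₂ (proj₂ (ear-sides-adjacent ear))

  adjacent⇒edge : a < b → b ≤ suc n → Adjacent a b → Edge n T a b
  adjacent⇒edge {a} {b} a<b b≤n+1 adj with b ≟ suc a | (a ≟ 0) ×-dec (b ≟ suc n)
  ... | yes b≡a+1 | _         = inj₁ b≡a+1
  ... | no  _     | yes outer = inj₂ (inj₁ outer)
  ... | no  b≢a+1 | no  inner with _ , ear ← adjacent⇒ear (≤∧≢⇒< a<b (b≢a+1 ∘ sym)) b≤n+1 adj =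
    inj₂ (inj₂ (ear⇒∈T ear inner))

  isTriangulation : IsTriangulation n T
  isTriangulation =
    trans (length-diags n [] σ) (cong (_∸ 1) length≡) , diags-unique [] σ unique apex-determined ,
    isDiagonal , noncrossing
    where
    apex-determined : ∀ {u z v u′ z′ v′} → σ ≡ u ++ z ∷ v → σ ≡ u′ ++ z′ ∷ v′ →
                      diagonal n [] u z ≡ diagonal n [] u′ z′ → z ≡ z′
    apex-determined {z′ = z′} eq eq′ d≡ =
      ear-apex-unique (ear-of-split eq) (subst (λ (a , b) → Ear a z′ b) (sym d≡) (ear-of-split eq′))
    isDiagonal : ∀ d → d ∈ T → IsDiagonal n d
    isDiagonal _ ab∈T with _ , ear@(a<z , z<b , _) , inner ← ∈T⇒ear ab∈T =
      ≤-trans (s≤s a<z) z<b , ear-bounded ear , inner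
    adjacent : ∀ {a b} → (a , b) ∈ T → Adjacent a b
    adjacent = edge⇒adjacent ∘ inj₂ ∘ inj₂
    noncrossing : ∀ d e → d ∈ T → e ∈ T → ¬ Cross d e
    noncrossing _ _ ab∈T cd∈T (inj₁ (a<c , c<b , b<d)) =
      adjacent-noncrossing a<c c<b b<d (adjacent ab∈T) (adjacent cd∈T)
    noncrossing _ _ ab∈T cd∈T (inj₂ (c<a , a<d , d<b)) =
      adjacent-noncrossing c<a a<d d<b (adjacent cd∈T) (adjacent ab∈T)

  ear⇒face : Ear a z b → IsFace n T a z b
  ear⇒face ear@(a<z , z<b , _) =
    let adjᵃᶻ , adjᶻᵇ , adjᵃᵇ = ear-sides-adjacent ear
        b≤n+1 = ear-bounded ear
    in a<z , z<b , b≤n+1 ,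
       adjacent⇒edge a<z (≤-trans (<⇒≤ z<b) b≤n+1) adjᵃᶻ ,
       adjacent⇒edge z<b b≤n+1 adjᶻᵇ ,
       adjacent⇒edge (<-trans a<z z<b) b≤n+1 adjᵃᵇ

  ear-exists : z ∈ σ → ∃[ a ] ∃[ b ] Ear a z b
  ear-exists z∈σ with _ , _ , eq ← ∈-∃++ z∈σ = _ , _ , ear-of-split eq

  ear-right≡suc : Ear a z b → r z < r (suc z) → b ≡ suc z
  ear-right≡suc {z = z} (a<z , z<b , _ , _ , below) rz<rz+1 with m≤n⇒m<n∨m≡n z<b
  ... | inj₁ z+1<b =
    contradiction (below (suc z) (<-trans a<z (n<1+n z)) z+1<b (<⇒≢ (n<1+n z) ∘ sym)) (<-asym rz<rz+1)
  ... | inj₂ z+1≡b = sym z+1≡b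

  ear-left≡pred : Ear a (suc z) b → r (suc z) < r z → a ≡ z
  ear-left≡pred {z = z} (a<z+1 , z+1<b , _ , _ , below) rz+1<rz with m≤n⇒m<n∨m≡n (≤-pred a<z+1)
  ... | inj₁ a<z = contradiction (below z a<z (<-trans (n<1+n z) z+1<b) (<⇒≢ (n<1+n z))) (<-asym rz+1<rz)
  ... | inj₂ a≡z = a≡z

  thirdVertex-exists : ∀ i → 1 ≤ i → i < n → ∃[ t ] ThirdVertex n T i t
  thirdVertex-exists i 1≤i i<n with <-cmp (r i) (r (suc i))
  ... | tri< ri<ri+1 _ _ with a , b , ear ← ear-exists (complete 1≤i (<⇒≤ i<n)) =
    a , inj₁ (subst (IsFace n T a i) (ear-right≡suc ear ri<ri+1) (ear⇒face ear))
  ... | tri≈ _ ri≡ri+1 _ = contradiction (rank-injective (complete (s≤s z≤n) i<n) ri≡ri+1) (<⇒≢ (n<1+n i))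
  ... | tri> _ _ ri+1<ri with a , b , ear ← ear-exists (complete (s≤s z≤n) i<n) =
    b , inj₂ (subst (λ a → IsFace n T a (suc i) b) (ear-left≡pred ear ri+1<ri) (ear⇒face ear))

  thirdVertex-cases : ThirdVertex n T x y → (y < x × Adjacent y (suc x)) ⊎ (suc x < y × Adjacent x y)
  thirdVertex-cases (inj₁ (y<x , _ , _ , _ , _ , edge)) = inj₁ (y<x , edge⇒adjacent edge)
  thirdVertex-cases (inj₂ (_ , x+1<y , _ , _ , _ , edge)) = inj₂ (x+1<y , edge⇒adjacent edge)

  thirdVertex-below⇔ : ThirdVertex n T i t → (t < i ⇔ r i < r (suc i))
  thirdVertex-below⇔ {i} tv with thirdVertex-cases tv
  ... | inj₁ (t<i , adj) = mk⇔ (λ _ → proj₂ (adj i t<i (n<1+n i))) (λ _ → t<i)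
  ... | inj₂ (i+1<t , adj) = mk⇔
    (λ t<i → contradiction (<-trans (n<1+n i) i+1<t) (<-asym t<i))
    (λ ri<ri+1 → contradiction ri<ri+1 (<-asym (proj₁ (adj (suc i) (n<1+n i) i+1<t))))

  thirdVertex-below⇒adjacent : ThirdVertex n T i t → t < i → Adjacent t (suc i)
  thirdVertex-below⇒adjacent {i} tv t<i with thirdVertex-cases tv
  ... | inj₁ (_ , adj)   = adj
  ... | inj₂ (i+1<t , _) = contradiction (<-trans (n<1+n i) i+1<t) (<-asym t<i)

  leftOf⇔thirdVertex-below : i < n → ThirdVertex n T i t → (LeftOf σ i (suc i) ⇔ t < i)
  leftOf⇔thirdVertex-below i<n tv =
    ⇔.trans (mk⇔ leftOf⇒rank< (rank<⇒leftOf (complete (s≤s z≤n) i<n))) (⇔.sym (thirdVertex-below⇔ tv))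

  thirdVertices-decrease : LeftOf σ k (suc k) → LeftOf σ (suc k) (suc (suc k)) →
                           ThirdVertex n T k t → ThirdVertex n T (suc k) t′ → t′ ≤ t
  thirdVertices-decrease {k} k≺k+1 k+1≺k+2 tv tv′ = ≮⇒≥ λ t<t′ →
    -- t < t′ would make the sides {t, k+1} and {t′, k+2} of the two faces cross
    adjacent-noncrossing t<t′ t′<k+1 (n<1+n (suc k))
      (thirdVertex-below⇒adjacent tv t<k) (thirdVertex-below⇒adjacent tv′ t′<k+1)
    where
    t<k    = Equivalence.from (thirdVertex-below⇔ tv) (leftOf⇒rank< k≺k+1)
    t′<k+1 = Equivalence.from (thirdVertex-below⇔ tv′) (leftOf⇒rank< k+1≺k+2)

  thirdVertices-on-increasing-run : ∀ i j → 2 + i ≤ j → (∀ k → i ≤ k → k < j → LeftOf σ k (suc k)) →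
    (∀ t → ThirdVertex n T i t → t < i)
    × (∀ k t t′ → i ≤ k → suc k < j → ThirdVertex n T k t → ThirdVertex n T (suc k) t′ → t′ ≤ t)
  thirdVertices-on-increasing-run i j i+2≤j run =
    (λ t tv → Equivalence.from (thirdVertex-below⇔ tv) (leftOf⇒rank< (run i ≤-refl i<j))) ,
    λ k t t′ i≤k k+1<j →
      thirdVertices-decrease (run k i≤k (<-trans (n<1+n k) k+1<j)) (run (suc k) (m≤n⇒m≤1+n i≤k) k+1<j)
    where
    i<j = ≤-trans (n≤1+n (suc i)) i+2≤j

-- Counting colors and standardization

private variable
  p : ℕ
  c d : Fin p
  ws us vs L : List (Fin p)

≡ᵇ-true : m ≡ x → (m ≡ᵇ x) ≡ true
≡ᵇ-true {m} {x} = dec-true (m ≟ x)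

≡ᵇ-false : m ≢ x → (m ≡ᵇ x) ≡ false
≡ᵇ-false {m} {x} = dec-false (m ≟ x)

<ᵇ-true : m < x → (m <ᵇ x) ≡ true
<ᵇ-true {m} {x} = dec-true (m <? x)

<ᵇ-false : ¬ m < x → (m <ᵇ x) ≡ false
<ᵇ-false {m} {x} = dec-false (m <? x)

count-∷-≡ : d ≡ c → count c (d ∷ ws) ≡ suc (count c ws)
count-∷-≡ {d = d} refl rewrite ≡ᵇ-true (refl {x = toℕ d}) = refl

count-∷-≢ : d ≢ c → count c (d ∷ ws) ≡ count c ws
count-∷-≢ d≢c rewrite ≡ᵇ-false (d≢c ∘ toℕ-injective) = refl

countLt-∷-< : toℕ d < toℕ c → countLt c (d ∷ ws) ≡ suc (countLt c ws)
countLt-∷-< d<c rewrite <ᵇ-true d<c = refl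

countLt-∷-≮ : ¬ toℕ d < toℕ c → countLt c (d ∷ ws) ≡ countLt c ws
countLt-∷-≮ d≮c rewrite <ᵇ-false d≮c = refl

count-++ : ∀ (c : Fin p) us vs → count c (us ++ vs) ≡ count c us + count c vs
count-++ c []       vs = refl
count-++ c (d ∷ us) vs with toℕ d ≡ᵇ toℕ c
... | true  = cong suc (count-++ c us vs)
... | false = count-++ c us vs

count-ʳ++ : ∀ (c : Fin p) us vs → count c (us ʳ++ vs) ≡ count c us + count c vs
count-ʳ++ c []       vs = refl
count-ʳ++ c (d ∷ us) vs with toℕ d ≡ᵇ toℕ c | count-ʳ++ c us (d ∷ vs)
... | true  | ih = trans ih (+-suc (count c us) (count c vs))
... | false | ih = ih

count-reverse : ∀ (c : Fin p) us → count c (reverse us) ≡ count c us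
count-reverse c us = trans (count-ʳ++ c us []) (+-identityʳ (count c us))

countLt+count≤length : ∀ (c : Fin p) ws → countLt c ws + count c ws ≤ length ws
countLt+count≤length c []       = z≤n
countLt+count≤length c (d ∷ ws) with <-cmp (toℕ d) (toℕ c)
... | tri< d<c d≢c _ rewrite countLt-∷-< {ws = ws} d<c | count-∷-≢ {ws = ws} (d≢c ∘ cong toℕ) =
  s≤s (countLt+count≤length c ws)
... | tri≈ d≮c d≡c _ rewrite countLt-∷-≮ {ws = ws} d≮c | count-∷-≡ {ws = ws} (toℕ-injective d≡c) =
  ≤-trans (≤-reflexive (+-suc (countLt c ws) (count c ws))) (s≤s (countLt+count≤length c ws))
... | tri> d≮c d≢c _ rewrite countLt-∷-≮ {ws = ws} d≮c | count-∷-≢ {ws = ws} (d≢c ∘ cong toℕ) =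
  m≤n⇒m≤1+n (countLt+count≤length c ws)

countLt≤countLt-∷ : ∀ (c : Fin p) d ws → countLt c ws ≤ countLt c (d ∷ ws)
countLt≤countLt-∷ c d ws with toℕ d <ᵇ toℕ c
... | true  = n≤1+n (countLt c ws)
... | false = ≤-refl

countLt+count≤countLt : ∀ {c c′ : Fin p} ws → toℕ c < toℕ c′ → countLt c ws + count c ws ≤ countLt c′ ws
countLt+count≤countLt             []       _    = z≤n
countLt+count≤countLt {c = c} {c′} (d ∷ ws) c<c′ with <-cmp (toℕ d) (toℕ c)
... | tri< d<c d≢c _ rewrite countLt-∷-< {ws = ws} d<c | count-∷-≢ {ws = ws} (d≢c ∘ cong toℕ)
                           | countLt-∷-< {ws = ws} (<-trans d<c c<c′) =
  s≤s (countLt+count≤countLt ws c<c′)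
... | tri≈ d≮c d≡c _ rewrite countLt-∷-≮ {ws = ws} d≮c | count-∷-≡ {ws = ws} (toℕ-injective d≡c)
                           | countLt-∷-< {ws = ws} (subst (_< toℕ c′) (sym d≡c) c<c′) =
  ≤-trans (≤-reflexive (+-suc (countLt c ws) (count c ws))) (s≤s (countLt+count≤countLt ws c<c′))
... | tri> d≮c d≢c _ rewrite countLt-∷-≮ {ws = ws} d≮c | count-∷-≢ {ws = ws} (d≢c ∘ cong toℕ) =
  ≤-trans (countLt+count≤countLt ws c<c′) (countLt≤countLt-∷ c′ d ws)

stdAux-split : ∀ (ws : List (Fin p)) seen us c vs →
  stdAux ws seen (us ++ c ∷ vs)
    ≡ stdAux ws seen us ++ (countLt c ws + suc (count c (us ʳ++ seen))) ∷ stdAux ws (c ∷ (us ʳ++ seen)) vs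
stdAux-split ws seen []       c vs = refl
stdAux-split ws seen (d ∷ us) c vs = cong (_ ∷_) (stdAux-split ws (d ∷ seen) us c vs)

length-stdAux : ∀ (ws : List (Fin p)) seen vs → length (stdAux ws seen vs) ≡ length vs
length-stdAux ws seen []       = refl
length-stdAux ws seen (c ∷ vs) = cong suc (length-stdAux ws (c ∷ seen) vs)

∈-stdAux⁻ : ∀ (ws : List (Fin p)) seen vs {y} → y ∈ stdAux ws seen vs →
  ∃[ us ] ∃[ c ] ∃[ vs′ ] vs ≡ us ++ c ∷ vs′ × y ≡ countLt c ws + suc (count c (us ʳ++ seen))
∈-stdAux⁻ ws seen (c ∷ vs) (here refl) = [] , c , vs , refl , refl
∈-stdAux⁻ ws seen (c ∷ vs) (there y∈)
  with us , c′ , vs′ , eq , y≡ ← ∈-stdAux⁻ ws (c ∷ seen) vs y∈ =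
  c ∷ us , c′ , vs′ , cong (c ∷_) eq , y≡

stdAux-unique : ∀ (ws : List (Fin p)) seen vs →
  (∀ {us c vs′ us′ c′ vs″} → vs ≡ us ++ c ∷ vs′ → vs ≡ us′ ++ c′ ∷ vs″ →
     countLt c ws + suc (count c (us ʳ++ seen)) ≡ countLt c′ ws + suc (count c′ (us′ ʳ++ seen)) → us ≡ us′) →
  Unique (stdAux ws seen vs)
stdAux-unique ws seen []       _   = []
stdAux-unique ws seen (c ∷ vs) inj =
  All.tabulate head-fresh ∷ stdAux-unique ws (c ∷ seen) vs
    λ {us} {_} {_} {us′} eq eq′ y≡ →
      ∷-injectiveʳ (inj {us = c ∷ us} {us′ = c ∷ us′} (cong (c ∷_) eq) (cong (c ∷_) eq′) y≡)
  where
  head-fresh : ∀ {y} → y ∈ stdAux ws (c ∷ seen) vs → countLt c ws + suc (count c seen) ≢ y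
  head-fresh y∈ y≡ with us , _ , _ , eq , refl ← ∈-stdAux⁻ ws (c ∷ seen) vs y∈
    with () ← inj {us = []} {us′ = c ∷ us} refl (cong (c ∷_) eq) y≡

module Standardisation {p} (w : List (Fin p)) where

  -- The letter std w puts at the occurrence of c that follows us.
  value : List (Fin p) → Fin p → ℕ
  value us c = countLt c w + suc (count c us)

  std-split : w ≡ us ++ c ∷ vs → std w ≡ stdAux w [] us ++ value us c ∷ stdAux w (c ∷ reverse us) vs
  std-split {us} {c} {vs} eq = begin
    stdAux w [] w                                                  ≡⟨ cong (stdAux w []) eq ⟩
    stdAux w [] (us ++ c ∷ vs)                                     ≡⟨ stdAux-split w [] us c vs ⟩
    stdAux w [] us ++ (countLt c w + suc (count c (reverse us))) ∷ stdAux w (c ∷ reverse us) vs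
      ≡⟨ cong (λ k → stdAux w [] us ++ (countLt c w + suc k) ∷ stdAux w (c ∷ reverse us) vs) (count-reverse c us) ⟩
    stdAux w [] us ++ value us c ∷ stdAux w (c ∷ reverse us) vs    ∎
    where open ≡-Reasoning

  ∈-std⁻ : y ∈ std w → ∃[ us ] ∃[ c ] ∃[ vs ] w ≡ us ++ c ∷ vs × y ≡ value us c
  ∈-std⁻ y∈ with us , c , vs , eq , refl ← ∈-stdAux⁻ w [] w y∈ =
    us , c , vs , eq , cong (λ k → countLt c w + suc k) (count-reverse c us)

  count-prefix< : w ≡ us ++ c ∷ vs → count c us < count c w
  count-prefix< {us} {c} {vs} refl = begin-strict
    count c us                        <⟨ m<m+n (count c us) (s≤s z≤n) ⟩
    count c us + suc (count c vs)     ≡⟨ cong (count c us +_) (count-∷-≡ {ws = vs} refl) ⟨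
    count c us + count c (c ∷ vs)     ≡⟨ count-++ c us (c ∷ vs) ⟨
    count c (us ++ c ∷ vs)            ∎
    where open ≤-Reasoning

  value-bounded : w ≡ us ++ c ∷ vs → 1 ≤ value us c × value us c ≤ length w
  value-bounded {us} {c} eq =
    ≤-trans (s≤s z≤n) (m≤n+m _ (countLt c w)) ,
    ≤-trans (+-monoʳ-≤ (countLt c w) (count-prefix< eq)) (countLt+count≤length c w)

  value-<-color : ∀ {c′ us′} → w ≡ us ++ c ∷ vs → toℕ c < toℕ c′ → value us c < value us′ c′
  value-<-color {us} {c} {c′ = c′} {us′} eq c<c′ = begin-strict
    countLt c w + suc (count c us)  ≤⟨ +-monoʳ-≤ (countLt c w) (count-prefix< eq) ⟩
    countLt c w + count c w         ≤⟨ countLt+count≤countLt w c<c′ ⟩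
    countLt c′ w                    <⟨ m<m+n (countLt c′ w) (s≤s z≤n) ⟩
    countLt c′ w + suc (count c′ us′) ∎
    where open ≤-Reasoning

  value-<-later : ∀ us (c : Fin p) m → value us c < value (us ++ c ∷ m) c
  value-<-later us c m = +-monoʳ-< (countLt c w) (s≤s (begin-strict
    count c us                    ≤⟨ m≤m+n (count c us) (count c m) ⟩
    count c us + count c m        <⟨ +-monoʳ-< (count c us) (n<1+n (count c m)) ⟩
    count c us + suc (count c m)  ≡⟨ cong (count c us +_) (count-∷-≡ {ws = m} refl) ⟨
    count c us + count c (c ∷ m)  ≡⟨ count-++ c us (c ∷ m) ⟨
    count c (us ++ c ∷ m)         ∎))
    where open ≤-Reasoning

  value-≢-later : ∀ {m c′ vs′} → w ≡ us ++ c ∷ vs → w ≡ (us ++ c ∷ m) ++ c′ ∷ vs′ →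
                  value us c ≢ value (us ++ c ∷ m) c′
  value-≢-later {us} {c} {m = m} {c′} eq eq′ with <-cmp (toℕ c) (toℕ c′)
  ... | tri< c<c′ _ _ = <⇒≢ (value-<-color {us′ = us ++ c ∷ m} eq c<c′)
  ... | tri≈ _ c≡c′ _ rewrite toℕ-injective c≡c′ = <⇒≢ (value-<-later us c′ m)
  ... | tri> _ _ c′<c = ≢-sym (<⇒≢ (value-<-color {us′ = us} eq′ c′<c))

  value-injective : ∀ {us′ c′ vs′} → w ≡ us ++ c ∷ vs → w ≡ us′ ++ c′ ∷ vs′ →
                    value us c ≡ value us′ c′ → us ≡ us′
  value-injective {us} {us′ = us′} eq eq′ v≡ with split-compare us us′ (trans (sym eq) eq′)
  ... | inj₁ (us≡us′ , _)      = us≡us′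
  ... | inj₂ (inj₁ (m , refl)) = contradiction (sym v≡) (value-≢-later eq′ eq)
  ... | inj₂ (inj₂ (m , refl)) = contradiction v≡ (value-≢-later eq eq′)

  std-unique : Unique (std w)
  std-unique = stdAux-unique w [] w λ {us} {c} {_} {us′} {c′} eq eq′ e≡ →
    value-injective eq eq′ (subst₂ (λ k k′ → countLt c w + suc k ≡ countLt c′ w + suc k′)
                              (count-reverse c us) (count-reverse c′ us′) e≡)

  std-permutation : PermutationOf (length w) (std w)
  std-permutation = record
    { unique  = std-unique
    ; bounded = λ y∈ → let _ , _ , _ , eq , y≡ = ∈-std⁻ y∈ in
                  subst (λ y → 1 ≤ y × y ≤ length w) (sym y≡) (value-bounded eq)
    ; length≡ = length-stdAux w [] w
    }

  rank-value : w ≡ us ++ c ∷ vs → rank (std w) (value us c) ≡ length us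
  rank-value {us} {c} eq = begin
    rank (std w) (value us c)                        ≡⟨ cong (λ σ → rank σ (value us c)) (std-split eq) ⟩
    rank (stdAux w [] us ++ value us c ∷ _) (value us c) ≡⟨ rank-split (subst Unique (std-split eq) std-unique) ⟩
    length (stdAux w [] us)                          ≡⟨ length-stdAux w [] us ⟩
    length us                                        ∎
    where open ≡-Reasoning

nth-replicate-++ : ∀ {A : Set} k (d : A) ys {j} → j < k → nth (replicate k d ++ ys) j ≡ just d
nth-replicate-++ (suc k) d ys {zero}  _         = refl
nth-replicate-++ (suc k) d ys {suc j} (s≤s j<k) = nth-replicate-++ k d ys j<k

nth-replicate-++-skip : ∀ {A : Set} k (d : A) ys j → nth (replicate k d ++ ys) (k + j) ≡ nth ys j
nth-replicate-++-skip zero    d ys j = refl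
nth-replicate-++-skip (suc k) d ys j = nth-replicate-++-skip k d ys j

nth-replicate-++⁻ : ∀ {A : Set} k (d : A) ys j {c} → nth (replicate k d ++ ys) j ≡ just c →
  (j < k × c ≡ d) ⊎ (∃[ j′ ] j ≡ k + j′ × nth ys j′ ≡ just c)
nth-replicate-++⁻ zero    d ys j       eq = inj₂ (j , refl , eq)
nth-replicate-++⁻ (suc k) d ys zero    eq = inj₁ (s≤s z≤n , sym (just-injective eq))
nth-replicate-++⁻ (suc k) d ys (suc j) eq with nth-replicate-++⁻ k d ys j eq
... | inj₁ (j<k , c≡d)        = inj₁ (s≤s j<k , c≡d)
... | inj₂ (j′ , refl , eq′) = inj₂ (j′ , refl , eq′)

nth-<-length : ∀ {A : Set} (xs : List A) j {c} → nth xs j ≡ just c → j < length xs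
nth-<-length (x ∷ xs) zero    _  = s≤s z≤n
nth-<-length (x ∷ xs) (suc j) eq = s≤s (nth-<-length xs j eq)

nth-defined : ∀ {A : Set} (xs : List A) j → j < length xs → ∃[ c ] nth xs j ≡ just c
nth-defined (x ∷ xs) zero    _         = x , refl
nth-defined (x ∷ xs) (suc j) (s≤s j<n) = nth-defined xs j j<n

blocks : (Fin p → ℕ) → List (Fin p) → List (Fin p)
blocks f = concatMap (λ c → replicate (f c) c)

sumWhere : (Fin p → Bool) → (Fin p → ℕ) → List (Fin p) → ℕ
sumWhere q f []      = 0
sumWhere q f (d ∷ L) = if q d then f d + sumWhere q f L else sumWhere q f L

countWhere : (Fin p → Bool) → List (Fin p) → ℕ
countWhere q []       = 0
countWhere q (d ∷ ws) = if q d then suc (countWhere q ws) else countWhere q ws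

length-blocks : ∀ (f : Fin p → ℕ) L → length (blocks f L) ≡ sumWhere (λ _ → true) f L
length-blocks f []      = refl
length-blocks f (d ∷ L) =
  trans (length-++ (replicate (f d) d)) (cong₂ _+_ (length-replicate (f d)) (length-blocks f L))

∈-blocks : ∀ (f : Fin p → ℕ) L j → nth (blocks f L) j ≡ just c → c ∈ L
∈-blocks f (d ∷ L) j eq with nth-replicate-++⁻ (f d) d (blocks f L) j eq
... | inj₁ (_ , refl)        = here refl
... | inj₂ (j′ , _ , eq′)    = there (∈-blocks f L j′ eq′)

sumWhere-below-least : ∀ (f : Fin p → ℕ) → All (λ d → toℕ c < toℕ d) L →
                       sumWhere (λ d → toℕ d <ᵇ toℕ c) f L ≡ 0
sumWhere-below-least f []            = refl
sumWhere-below-least f (c<d ∷ c<L) rewrite <ᵇ-false (<-asym c<d) = sumWhere-below-least f c<L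

nth-blocks : ∀ (f : Fin p → ℕ) {m} → AllPairs F._<_ L → c ∈ L → m < f c →
  nth (blocks f L) (sumWhere (λ d → toℕ d <ᵇ toℕ c) f L + m) ≡ just c
nth-blocks {c = c} f {m} (c<L ∷ _) (here refl) m<fc
  rewrite <ᵇ-false (<-irrefl (refl {x = toℕ c})) | sumWhere-below-least f c<L =
  nth-replicate-++ (f c) c _ m<fc
nth-blocks {L = d ∷ L} {c = c} f {m} (d<L ∷ increasing) (there c∈L) m<fc
  rewrite <ᵇ-true (All.lookup d<L c∈L) | +-assoc (f d) (sumWhere (λ d → toℕ d <ᵇ toℕ c) f L) m =
  trans (nth-replicate-++-skip (f d) d (blocks f L) _) (nth-blocks f increasing c∈L m<fc)

blocks-sorted : ∀ (f : Fin p → ℕ) {L} j j′ → AllPairs F._<_ L →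
  nth (blocks f L) j ≡ just c → nth (blocks f L) j′ ≡ just d → j ≤ j′ → c F.≤ d
blocks-sorted f {e ∷ L} j j′ (e<L ∷ increasing) eq eq′ j≤j′
  with nth-replicate-++⁻ (f e) e (blocks f L) j eq | nth-replicate-++⁻ (f e) e (blocks f L) j′ eq′
... | inj₁ (_ , refl)         | inj₁ (_ , refl)          = ≤-refl
... | inj₁ (_ , refl)         | inj₂ (j₂ , _ , eq₂)      = <⇒≤ (All.lookup e<L (∈-blocks f L j₂ eq₂))
... | inj₂ (j₁ , refl , _)    | inj₁ (j′<fe , _)         = contradiction (≤-trans (m≤m+n (f e) j₁) j≤j′) (<⇒≱ j′<fe)
... | inj₂ (j₁ , refl , eq₁)  | inj₂ (j₂ , refl , eq₂)   =
  blocks-sorted f j₁ j₂ increasing eq₁ eq₂ (+-cancelˡ-≤ (f e) j₁ j₂ j≤j′)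

countWhere-∷ : ∀ (q : Fin p → Bool) d ws → countWhere q (d ∷ ws) ≡ countWhere q [ d ] + countWhere q ws
countWhere-∷ q d ws with q d
... | true  = refl
... | false = refl

countWhere-true : ∀ (ws : List (Fin p)) → countWhere (λ _ → true) ws ≡ length ws
countWhere-true []       = refl
countWhere-true (_ ∷ ws) = cong suc (countWhere-true ws)

countWhere-below : ∀ (c : Fin p) ws → countWhere (λ d → toℕ d <ᵇ toℕ c) ws ≡ countLt c ws
countWhere-below c []       = refl
countWhere-below c (d ∷ ws) with toℕ d <ᵇ toℕ c
... | true  = cong suc (countWhere-below c ws)
... | false = countWhere-below c ws

sumWhere-zero : ∀ (q : Fin p → Bool) L → sumWhere q (λ _ → 0) L ≡ 0
sumWhere-zero q []      = refl
sumWhere-zero q (d ∷ L) with q d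
... | true  = sumWhere-zero q L
... | false = sumWhere-zero q L

sumWhere-count-fresh : ∀ (q : Fin p → Bool) {d} L ws → d ∉ L →
  sumWhere q (λ c → count c (d ∷ ws)) L ≡ sumWhere q (λ c → count c ws) L
sumWhere-count-fresh q     []      ws _  = refl
sumWhere-count-fresh q {d} (e ∷ L) ws d∉ with q e
... | true  = cong₂ _+_ (count-∷-≢ {ws = ws} (d∉ ∘ here)) (sumWhere-count-fresh q L ws (d∉ ∘ there))
... | false = sumWhere-count-fresh q L ws (d∉ ∘ there)

sumWhere-count-∷ : ∀ (q : Fin p → Bool) {d} L ws → Unique L → d ∈ L →
  sumWhere q (λ c → count c (d ∷ ws)) L ≡ countWhere q [ d ] + sumWhere q (λ c → count c ws) L
sumWhere-count-∷ q {d} (d ∷ L) ws (d≢L ∷ _) (here refl) with q d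
... | true  = cong₂ _+_ (count-∷-≡ {ws = ws} refl) (sumWhere-count-fresh q L ws (All¬⇒¬Any d≢L))
... | false = sumWhere-count-fresh q L ws (All¬⇒¬Any d≢L)
sumWhere-count-∷ q {d} (e ∷ L) ws (e≢L ∷ unique) (there d∈L) with q e
... | true  = begin
    count e (d ∷ ws) + sumWhere q (λ c → count c (d ∷ ws)) L
      ≡⟨ cong₂ _+_ (count-∷-≢ {ws = ws} (≢-sym (All.lookup e≢L d∈L))) (sumWhere-count-∷ q L ws unique d∈L) ⟩
    count e ws + (countWhere q [ d ] + sumWhere q (λ c → count c ws) L)
      ≡⟨ x∙yz≈y∙xz +-commutativeSemigroup (count e ws) (countWhere q [ d ]) _ ⟩
    countWhere q [ d ] + (count e ws + sumWhere q (λ c → count c ws) L) ∎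
  where open ≡-Reasoning
... | false = sumWhere-count-∷ q L ws unique d∈L

sumWhere-count : ∀ (q : Fin p → Bool) L → Unique L → (∀ c → c ∈ L) →
  ∀ ws → sumWhere q (λ c → count c ws) L ≡ countWhere q ws
sumWhere-count q L unique every []       = sumWhere-zero q L
sumWhere-count q L unique every (d ∷ ws) = begin
  sumWhere q (λ c → count c (d ∷ ws)) L              ≡⟨ sumWhere-count-∷ q L ws unique (every d) ⟩
  countWhere q [ d ] + sumWhere q (λ c → count c ws) L
    ≡⟨ cong (countWhere q [ d ] +_) (sumWhere-count q L unique every ws) ⟩
  countWhere q [ d ] + countWhere q ws                 ≡⟨ countWhere-∷ q d ws ⟨
  countWhere q (d ∷ ws)                                ∎
  where open ≡-Reasoning

toList-tabulate : ∀ {A : Set} {k} (f : Fin k → A) → V.toList (V.tabulate f) ≡ tabulate f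
toList-tabulate {k = zero}  f = refl
toList-tabulate {k = suc k} f = cong (f F.zero ∷_) (toList-tabulate (f ∘ F.suc))

allFinL-increasing : ∀ p → AllPairs F._<_ (allFinL p)
allFinL-increasing p = subst (AllPairs F._<_) (sym (toList-tabulate id)) (AllPairsₚ.tabulate⁺-< id)

allFinL-unique : ∀ p → Unique (allFinL p)
allFinL-unique p = AllPairs.map (λ c<d → <⇒≢ c<d ∘ cong toℕ) (allFinL-increasing p)

∈-allFinL : ∀ (c : Fin p) → c ∈ allFinL p
∈-allFinL c = subst (c ∈_) (sym (toList-tabulate id)) (∈-allFin c)

-- Simple colored triangulations

module Coloring {p} (w : List (Fin p)) where

  open Standardisation w
  open Triangulation std-permutation

  -- Definitionally blocks (λ c → count c w) (allFinL p).
  ε : List (Fin p)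
  ε = epsMu w

  length-ε : length ε ≡ length w
  length-ε = begin
    length ε                                                ≡⟨ length-blocks (λ c → count c w) (allFinL p) ⟩
    sumWhere (λ _ → true) (λ c → count c w) (allFinL p)     ≡⟨ sumWhere-count _ _ (allFinL-unique p) ∈-allFinL w ⟩
    countWhere (λ _ → true) w                               ≡⟨ countWhere-true w ⟩
    length w                                                ∎
    where open ≡-Reasoning

  color-of-value : w ≡ us ++ c ∷ vs → colorOf ε (value us c) ≡ just c
  color-of-value {us} {c} eq = begin
    colorOf ε (countLt c w + suc (count c us))   ≡⟨ cong (colorOf ε) (+-suc (countLt c w) (count c us)) ⟩
    nth ε (countLt c w + count c us)             ≡⟨ cong (λ o → nth ε (o + count c us)) offset ⟨
    nth ε (sumWhere (λ d → toℕ d <ᵇ toℕ c) (λ d → count d w) (allFinL p) + count c us)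
                                                 ≡⟨ nth-blocks _ (allFinL-increasing p) (∈-allFinL c) (count-prefix< eq) ⟩
    just c                                       ∎
    where
    open ≡-Reasoning
    offset = trans (sumWhere-count _ _ (allFinL-unique p) ∈-allFinL w) (countWhere-below c w)

  color-bounded : colorOf ε a ≡ just c → 1 ≤ a × a ≤ length w
  color-bounded {suc a} eq = s≤s z≤n , subst (a <_) length-ε (nth-<-length ε a eq)

  color-defined : 1 ≤ a → a ≤ length w → ∃[ c ] colorOf ε a ≡ just c
  color-defined {suc a} _ a<n = nth-defined ε a (subst (a <_) (sym length-ε) a<n)

  color-mono : a ≤ b → colorOf ε a ≡ just c → colorOf ε b ≡ just d → c F.≤ d
  color-mono {suc a} {suc b} (s≤s a≤b) eq eq′ = blocks-sorted _ a b (allFinL-increasing p) eq eq′ a≤b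

  colored⇒∈std : colorOf ε a ≡ just c → a ∈ std w
  colored⇒∈std {a} ca = let 1≤a , a≤n = color-bounded {a} ca in complete 1≤a a≤n

  same-color⇒rank< : colorOf ε a ≡ just c → colorOf ε b ≡ just c → a < b → r a < r b
  same-color⇒rank< {a} {c} {b} ca cb a<b
    with us , c₁ , vs , eq , refl ← ∈-std⁻ (colored⇒∈std {a} ca)
       | us′ , c₂ , vs′ , eq′ , refl ← ∈-std⁻ (colored⇒∈std {b} cb)
    with refl ← just-injective (trans (sym (color-of-value eq)) ca)
       | refl ← just-injective (trans (sym (color-of-value eq′)) cb)
    with split-compare us us′ (trans (sym eq) eq′)
  ... | inj₁ (refl , _)       = contradiction a<b (<-irrefl refl)
  ... | inj₂ (inj₁ (m , refl)) = contradiction a<b (<-asym (value-<-later us′ c m))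
  ... | inj₂ (inj₂ (m , refl)) = begin-strict
    r (value us c)              ≡⟨ rank-value eq ⟩
    length us                   <⟨ m<m+n (length us) (s≤s z≤n) ⟩
    length us + length (c ∷ m)  ≡⟨ length-++ us ⟨
    length (us ++ c ∷ m)        ≡⟨ rank-value eq′ ⟨
    r (value (us ++ c ∷ m) c)   ∎
    where open ≤-Reasoning

  sorted-ε : ∀ i c d → nth ε i ≡ just c → nth ε (suc i) ≡ just d → c F.≤ d
  sorted-ε i c d = color-mono {suc i} {suc (suc i)} (n≤1+n (suc i))

  monochromatic-side : ∀ i c t → 1 ≤ i → i < length w → colorOf ε i ≡ just c → colorOf ε (suc i) ≡ just c →
                       ThirdVertex (length w) T i t → t < i
  monochromatic-side i c t _ _ ci ci+1 tv =
    Equivalence.from (thirdVertex-below⇔ tv) (same-color⇒rank< {i} {c} {suc i} ci ci+1 (n<1+n i))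

  ear-not-monochromatic : Ear a z b → colorOf ε a ≡ just c → colorOf ε b ≢ just c
  ear-not-monochromatic {a} {z} {b} {c} (a<z , z<b , rz<ra , _) ca cb =
    let d , cz = color-defined {z} (≤-trans (proj₁ (color-bounded {a} ca)) (<⇒≤ a<z))
                                    (≤-trans (<⇒≤ z<b) (proj₂ (color-bounded {b} cb)))
        d≡c = toℕ-injective
                (≤-antisym (color-mono {z} {b} (<⇒≤ z<b) cz cb) (color-mono {a} {z} (<⇒≤ a<z) ca cz))
    in <-asym rz<ra (same-color⇒rank< {a} {c} {z} ca (subst (λ e → colorOf ε z ≡ just e) d≡c cz) a<z)

  simple : Simple (length w) T ε
  simple = isTriangulation , length-ε , sorted-ε ,
    (λ a b c ab∈T → let _ , ear , _ = ∈T⇒ear ab∈T in ear-not-monochromatic ear) , monochromatic-side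

mainTheorem2 :
    (∀ (n : ℕ) (σ : List ℕ) → IsPerm n σ →
      -- existence of the face containing the side {x_i , x_{i+1}}
      (∀ i → 1 ≤ i → i < n → ∃[ t ] ThirdVertex n (phi n σ) i t)
      -- (1)
      × (∀ i t → 1 ≤ i → i < n → ThirdVertex n (phi n σ) i t →
           (LeftOf σ i (suc i) ⇔ t < i))
      -- (2)
      × (∀ i j → 1 ≤ i → j ≤ n → 2 + i ≤ j →
           (∀ k → i ≤ k → k < j → LeftOf σ k (suc k)) →
           (∀ t → ThirdVertex n (phi n σ) i t → t < i)
           × (∀ k t t′ → i ≤ k → suc k < j →
                ThirdVertex n (phi n σ) k t → ThirdVertex n (phi n σ) (suc k) t′ → t′ ≤ t)))
    -- (3)
    × (∀ (p : ℕ) (w : List (Fin p)) → Simple (length w) (PhiT w) (epsMu w))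
mainTheorem2 =
  (λ n σ σ-perm → let open Triangulation (isPerm⇒permutationOf σ-perm) in
     thirdVertex-exists , (λ _ _ _ → leftOf⇔thirdVertex-below) ,
     λ i j _ _ → thirdVertices-on-increasing-run i j) ,
  λ p w → Coloring.simple w
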